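{- If $G$ is a cograph, then $\chi_{\text{lid}}(G)\leq 2\omega(G)-1$.
   Context: A cograph is a graph with no induced subgraph isomorphic to the path $P_4$ on four vertices. $\omega(G)$ is the clique number. For a vertex $u$, $N[u]$ is its closed neighborhood; for a coloring $c$ and vertex set $S$, $c(S)$ is the set of colors on $S$. A lid-coloring of $G$ is a proper vertex-coloring $c$ such that for every edge $uv$ with $N[u]\neq N[v]$, $c(N[u])\neq c(N[v])$; $\chi_{\text{lid}}(G)$ is the minimum number of colors in a lid-coloring of $G$. -}

module Defs where

open import Data.Nat using (ℕ; _≤_)
open import Data.Fin using (Fin)
open import Data.Fin.Subset using (Subset; _∈_; ∣_∣)
open import Data.Product using (Σ; _×_; ∃; ∃-syntax; _,_)
open import Relation.Binary.PropositionalEquality using (_≡_)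
open import Relation.Nullary using (¬_; Dec)
open import Relation.Binary using (Decidable)
open import Level using (0ℓ)

record Graph (n : ℕ) : Set₁ where
  field
    Adj     : Fin n → Fin n → Set
    adj?    : Decidable Adj
    symm    : ∀ {u v} → Adj u v → Adj v u
    irrefl  : ∀ {u} → ¬ Adj u u

open Graph public

module _ {n : ℕ} (G : Graph n) where

  InN : Fin n → Fin n → Set
  InN u w = (w ≡ u) Data.Sum.⊎ Adj G u w
    where import Data.Sum

  -- G contains an induced P4: a - b - c - d, with no other edges
  -- (distinctness of a,b,c,d follows from these adjacencies/non-adjacencies and irreflexivity)
  HasInducedP4 : Set
  HasInducedP4 =
    ∃[ a ] ∃[ b ] ∃[ c ] ∃[ d ]
      (Adj G a b × Adj G b c × Adj G c d ×
       ¬ Adj G a c × ¬ Adj G a d × ¬ Adj G b d)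

  IsCograph : Set
  IsCograph = ¬ HasInducedP4

  IsClique : Subset n → Set
  IsClique S = ∀ u v → u ∈ S → v ∈ S → ¬ (u ≡ v) → Adj G u v

  IsCliqueNumber : ℕ → Set
  IsCliqueNumber ω =
    (Σ (Subset n) λ S → IsClique S × ∣ S ∣ ≡ ω) ×
    (∀ S → IsClique S → ∣ S ∣ ≤ ω)

  IsProperColoring : {k : ℕ} → (Fin n → Fin k) → Set
  IsProperColoring c = ∀ u v → Adj G u v → ¬ (c u ≡ c v)

  SameClosedNbhd : Fin n → Fin n → Set
  SameClosedNbhd u v = ∀ w → (InN u w → InN v w) × (InN v w → InN u w)

  ColorIn : {k : ℕ} → (Fin n → Fin k) → Fin n → Fin k → Set
  ColorIn c u col = ∃[ w ] (InN u w × c w ≡ col)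

  SameColorSet : {k : ℕ} → (Fin n → Fin k) → Fin n → Fin n → Set
  SameColorSet c u v =
    ∀ col → (ColorIn c u col → ColorIn c v col) × (ColorIn c v col → ColorIn c u col)

  IsLidColoring : {k : ℕ} → (Fin n → Fin k) → Set
  IsLidColoring c =
    IsProperColoring c ×
    (∀ u v → Adj G u v → ¬ SameClosedNbhd u v → ¬ SameColorSet c u v)

  LidColorableWith : ℕ → Set
  LidColorableWith k = Σ (Fin n → Fin k) IsLidColoring

module Submission where

-- The proof follows the cograph decomposition.  First the splitting lemma:
-- in a cograph every vertex set with at least two vertices is partitioned
-- into two nonempty parts with no edges or all edges between them.  It is
-- proved by adding vertices one at a time, using that an induced P4 would
-- otherwise appear; a complete split is an anticomplete split of the
-- complement, which is again a cograph.  Then, by induction on the size of a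
-- nonempty vertex set S, we find a clique of order k in S together with a
-- lid-colouring of G[S] with 2k − 1 colours ("narrow") and one with 2k
-- colours ("wide") in which every vertex seeing all colours is universal and
-- a universal vertex leaves a colour unused.  Across an anticomplete split
-- the sides are coloured independently, after permuting the colours of one
-- side; across a complete split the colours of one side are shifted above
-- those of the other.  For S the whole vertex set we have k ≤ ω.

open import Defs
open import Data.Nat using (ℕ; _∸_; _*_)

open import Data.Nat using (zero; suc; _+_; _≤_; _<_; z≤n; s≤s)
open import Data.Nat.Properties
open import Data.Bool using (Bool; true; false; T; _∨_; if_then_else_)
open import Data.Bool.Properties using (T-∨)
open import Data.Empty using (⊥; ⊥-elim)
open import Data.Unit using (⊤; tt)
open import Data.Product using (Σ; _×_; ∃; _,_; proj₁; proj₂)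
import Data.Product as Product
open import Data.Sum using (_⊎_; inj₁; inj₂; [_,_])
import Data.Sum as Sum
open import Data.Fin using (Fin; zero; suc; toℕ; fromℕ<)
open import Data.Fin.Properties using (any?; all?; toℕ-fromℕ<) renaming (_≟_ to _≟ᶠ_)
open import Data.Fin.Subset using (∣_∣) renaming (_∈_ to _∈ˢ_; _⊆_ to _⊆ˢ_)
open import Data.Fin.Subset.Properties using (p⊂q⇒∣p∣<∣q∣; ∣⊥∣≡0; ∉⊥)
open import Data.Vec using (tabulate)
open import Data.Vec.Properties using (lookup∘tabulate; []=⇒lookup; lookup⇒[]=)
open import Data.List using (List; []; _∷_; filter; allFin)
open import Data.List.Relation.Unary.Any using (here; there)
import Data.List.Relation.Unary.Any as Any
open import Data.List.Membership.Propositional using (_∈_)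
open import Data.List.Membership.Propositional.Properties using (∈-filter⁺; ∈-filter⁻; ∈-allFin)
open import Function using (_∘_; Equivalence)
open import Relation.Binary.PropositionalEquality using (_≡_; refl; sym; trans; cong; subst; subst₂)
open import Relation.Unary using (Decidable)
open import Relation.Nullary using (¬_; Dec; yes; no; ¬?)
open import Relation.Nullary.Decidable
  using (isYes; toWitness; fromWitness; decidable-stable; _×-dec_; _⊎-dec_; _→-dec_; T?)

variable
  n : ℕ

VSet : ℕ → Set
VSet n = Fin n → Bool

_∈ᵥ_ : Fin n → VSet n → Set
z ∈ᵥ S = T (S z)

_⊆ᵥ_ : VSet n → VSet n → Set
A ⊆ᵥ S = ∀ z → z ∈ᵥ A → z ∈ᵥ S

Disjoint : VSet n → VSet n → Set
Disjoint A B = ∀ z → z ∈ᵥ A → ¬ z ∈ᵥ B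

_∪ᵥ_ : VSet n → VSet n → VSet n
(A ∪ᵥ B) z = A z ∨ B z

size : VSet n → ℕ
size S = ∣ tabulate S ∣

∈-tabulate⁺ : (S : VSet n) {z : Fin n} → z ∈ᵥ S → z ∈ˢ tabulate S
∈-tabulate⁺ S {z} z∈S with S z in eq
... | true = lookup⇒[]= z (tabulate S) (trans (lookup∘tabulate S z) eq)

∈-tabulate⁻ : (S : VSet n) {z : Fin n} → z ∈ˢ tabulate S → z ∈ᵥ S
∈-tabulate⁻ S {z} z∈S rewrite sym (lookup∘tabulate S z) | []=⇒lookup z∈S = tt

tabulate-⊆ : {A S : VSet n} → A ⊆ᵥ S → tabulate A ⊆ˢ tabulate S
tabulate-⊆ {A = A} {S} A⊆S z∈A = ∈-tabulate⁺ S (A⊆S _ (∈-tabulate⁻ A z∈A))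

size-strict : {A S : VSet n} → A ⊆ᵥ S → ∀ z → z ∈ᵥ S → ¬ z ∈ᵥ A → size A < size S
size-strict {A = A} {S} A⊆S z z∈S z∉A =
  p⊂q⇒∣p∣<∣q∣ (tabulate-⊆ A⊆S , z , ∈-tabulate⁺ S z∈S , z∉A ∘ ∈-tabulate⁻ A)

size-nonempty : (S : VSet n) → ∀ z → z ∈ᵥ S → 1 ≤ size S
size-nonempty {n} S z z∈S =
  subst (_< size S) (∣⊥∣≡0 n) (p⊂q⇒∣p∣<∣q∣ ((λ x∈⊥ → ⊥-elim (∉⊥ x∈⊥)) , z , ∈-tabulate⁺ S z∈S , ∉⊥))

size-∪ : (A B : VSet n) → Disjoint A B → size (A ∪ᵥ B) ≡ size A + size B
size-∪ {zero} A B disj = refl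
size-∪ {suc n} A B disj with A zero | B zero | disj zero | size-∪ (A ∘ suc) (B ∘ suc) (disj ∘ suc)
... | true  | true  | disj₀ | ih = ⊥-elim (disj₀ tt tt)
... | true  | false | disj₀ | ih = cong suc ih
... | false | true  | disj₀ | ih = trans (cong suc ih) (sym (+-suc _ _))
... | false | false | disj₀ | ih = ih

setOf : {P : Fin n → Set} → Decidable P → VSet n
setOf P? z = isYes (P? z)

∈-setOf⁺ : {P : Fin n → Set} (P? : Decidable P) {z : Fin n} → P z → z ∈ᵥ setOf P?
∈-setOf⁺ P? = fromWitness

∈-setOf⁻ : {P : Fin n → Set} (P? : Decidable P) {z : Fin n} → z ∈ᵥ setOf P? → P z
∈-setOf⁻ P? = toWitness

complement : Graph n → Graph n
complement H = record
  { Adj    = λ u v → ¬ u ≡ v × ¬ Adj H u v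
  ; adj?   = λ u v → ¬? (u ≟ᶠ v) ×-dec ¬? (adj? H u v)
  ; symm   = λ (u≢v , ¬uv) → u≢v ∘ sym , ¬uv ∘ symm H
  ; irrefl = λ (u≢u , _) → u≢u refl
  }

adjacent-from-complement : (H : Graph n) → ∀ u v → ¬ u ≡ v → ¬ Adj (complement H) u v → Adj H u v
adjacent-from-complement H u v u≢v ¬uv = decidable-stable (adj? H u v) (λ ¬uv′ → ¬uv (u≢v , ¬uv′))

-- The complement of a cograph is a cograph: an induced P4 a-b-c-d of the
-- complement is the induced P4 b-d-a-c of H.
complement-cograph : (H : Graph n) → IsCograph H → IsCograph (complement H)
complement-cograph H cograph (a , b , c , d , ab , bc , cd , ¬ac , ¬ad , ¬bd) =
  cograph (b , d , a , c ,
           back b d (λ { refl → ¬ad ab }) ¬bd ,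
           symm H (back a d (λ { refl → ¬ac (symm (complement H) cd) }) ¬ad) ,
           back a c (λ { refl → ¬ad cd }) ¬ac ,
           proj₂ ab ∘ symm H , proj₂ bc , proj₂ cd ∘ symm H)
  where
  back : ∀ u v → ¬ u ≡ v → ¬ Adj (complement H) u v → Adj H u v
  back = adjacent-from-complement H

Anticomplete : Graph n → VSet n → VSet n → Set
Anticomplete H A B = ∀ a b → a ∈ᵥ A → b ∈ᵥ B → ¬ Adj H a b

Complete : Graph n → VSet n → VSet n → Set
Complete H A B = ∀ a b → a ∈ᵥ A → b ∈ᵥ B → Adj H a b

record Split (H : Graph n) (P : Fin n → Set) : Set where
  field
    A B         : VSet n
    cover       : ∀ z → P z → z ∈ᵥ A ⊎ z ∈ᵥ B
    A⊆P         : ∀ z → z ∈ᵥ A → P z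
    B⊆P         : ∀ z → z ∈ᵥ B → P z
    disjoint    : Disjoint A B
    A-inhabited : ∃ (_∈ᵥ A)
    B-inhabited : ∃ (_∈ᵥ B)
    homogeneous : Anticomplete H A B ⊎ Complete H A B

  parts : Fin n → Set
  parts z = z ∈ᵥ A ⊎ z ∈ᵥ B

  parts? : Decidable parts
  parts? z = T? (A z) ⊎-dec T? (B z)

  parts⇒P : ∀ {z} → parts z → P z
  parts⇒P = [ A⊆P _ , B⊆P _ ]

  distinct : ∀ a b → a ∈ᵥ A → b ∈ᵥ B → ¬ a ≡ b
  distinct a _ a∈A b∈B refl = disjoint a a∈A b∈B

open Split

insert : Fin n → (Fin n → Set) → Fin n → Set
insert x P z = z ≡ x ⊎ P z

module _ {H : Graph n} where

  split-cong : {P Q : Fin n → Set} → (∀ z → Q z → P z) → (∀ z → P z → Q z) → Split H P → Split H Q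
  split-cong Q⇒P P⇒Q d = record
    { A = A d ; B = B d ; cover = λ z → cover d z ∘ Q⇒P z
    ; A⊆P = λ z → P⇒Q z ∘ A⊆P d z ; B⊆P = λ z → P⇒Q z ∘ B⊆P d z
    ; disjoint = disjoint d ; A-inhabited = A-inhabited d ; B-inhabited = B-inhabited d
    ; homogeneous = homogeneous d }

  split-swap : {P : Fin n → Set} → Split H P → Split H P
  split-swap d = record
    { A = B d ; B = A d ; cover = λ z → Sum.swap ∘ cover d z
    ; A⊆P = B⊆P d ; B⊆P = A⊆P d
    ; disjoint = λ z b∈B a∈A → disjoint d z a∈A b∈B
    ; A-inhabited = B-inhabited d ; B-inhabited = A-inhabited d
    ; homogeneous = Sum.map (λ anti b a b∈B a∈A → anti a b a∈A b∈B ∘ symm H)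
                            (λ comp b a b∈B a∈A → symm H (comp a b a∈A b∈B)) (homogeneous d) }

  split-complement : {P : Fin n → Set} → Split H P → Split (complement H) P
  split-complement d = record
    { A = A d ; B = B d ; cover = cover d ; A⊆P = A⊆P d ; B⊆P = B⊆P d
    ; disjoint = disjoint d ; A-inhabited = A-inhabited d ; B-inhabited = B-inhabited d
    ; homogeneous = Sum.swap (Sum.map (λ anti a b a∈A b∈B → distinct d a b a∈A b∈B , anti a b a∈A b∈B)
                                      (λ comp a b a∈A b∈B ab → proj₂ ab (comp a b a∈A b∈B)) (homogeneous d)) }

  split-from-complement : {P : Fin n → Set} → Split (complement H) P → Split H P
  split-from-complement d = record
    { A = A d ; B = B d ; cover = cover d ; A⊆P = A⊆P d ; B⊆P = B⊆P d
    ; disjoint = disjoint d ; A-inhabited = A-inhabited d ; B-inhabited = B-inhabited d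
    ; homogeneous = Sum.swap (Sum.map
        (λ anti a b a∈A b∈B → adjacent-from-complement H a b (distinct d a b a∈A b∈B) (anti a b a∈A b∈B))
        (λ comp a b a∈A b∈B ab → proj₂ (comp a b a∈A b∈B) ab) (homogeneous d)) }

module _ (H : Graph n) {P : Fin n → Set} (d : Split H P) (x : Fin n) (x∉P : ¬ P x) where

  add-beside-B : Anticomplete H (A d) (B d) → (∀ a → a ∈ᵥ A d → ¬ Adj H x a) → Split H (insert x P)
  add-beside-B anti x≁A = record
    { A = A d ; B = setOf B′?
    ; cover = λ { z (inj₁ refl) → inj₂ (∈-setOf⁺ B′? (inj₁ refl))
                ; z (inj₂ z∈P) → Sum.map₂ (∈-setOf⁺ B′? ∘ inj₂) (cover d z z∈P) }
    ; A⊆P = λ z → inj₂ ∘ A⊆P d z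
    ; B⊆P = λ z → Sum.map₂ (B⊆P d z) ∘ ∈-setOf⁻ B′?
    ; disjoint = λ z z∈A → [ (λ { refl → x∉P (A⊆P d x z∈A) }) , disjoint d z z∈A ] ∘ ∈-setOf⁻ B′?
    ; A-inhabited = A-inhabited d
    ; B-inhabited = x , ∈-setOf⁺ B′? (inj₁ refl)
    ; homogeneous = inj₁ λ a b a∈A b∈B′ →
        [ (λ { refl → x≁A a a∈A ∘ symm H }) , anti a b a∈A ] (∈-setOf⁻ B′? b∈B′) }
    where
    B′? : Decidable (λ z → z ≡ x ⊎ z ∈ᵥ B d)
    B′? z = (z ≟ᶠ x) ⊎-dec T? (B d z)

  add-apex : (∀ z → P z → Adj H x z) → Split H (insert x P)
  add-apex x∼P = record
    { A = setOf (_≟ᶠ x) ; B = setOf (parts? d)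
    ; cover = λ { z (inj₁ z≡x) → inj₁ (∈-setOf⁺ (_≟ᶠ x) z≡x)
                ; z (inj₂ z∈P) → inj₂ (∈-setOf⁺ (parts? d) (cover d z z∈P)) }
    ; A⊆P = λ z → inj₁ ∘ ∈-setOf⁻ (_≟ᶠ x)
    ; B⊆P = λ z → inj₂ ∘ parts⇒P d ∘ ∈-setOf⁻ (parts? d)
    ; disjoint = λ z z≡x z∈P → x∉P (subst P (∈-setOf⁻ (_≟ᶠ x) z≡x) (parts⇒P d (∈-setOf⁻ (parts? d) z∈P)))
    ; A-inhabited = x , ∈-setOf⁺ (_≟ᶠ x) refl
    ; B-inhabited = Product.map₂ (∈-setOf⁺ (parts? d) ∘ inj₁) (A-inhabited d)
    ; homogeneous = inj₂ λ a b a≡x b∈P →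
        subst (λ a → Adj H a b) (sym (∈-setOf⁻ (_≟ᶠ x) a≡x)) (x∼P b (parts⇒P d (∈-setOf⁻ (parts? d) b∈P))) }

  -- If A and B are anticomplete and x has a neighbour a₀ ∈ A, a neighbour
  -- b₀ ∈ B and some non-neighbour in P, then the non-neighbours M of x in P
  -- are anticomplete to x together with its neighbours in P: an edge from
  -- m ∈ M to a neighbour p of x inside A (resp. B) would give the induced
  -- P4  m - p - x - b₀  (resp.  m - p - x - a₀).
  add-splitting : IsCograph H → Anticomplete H (A d) (B d)
                → ∀ {a₀ b₀} → a₀ ∈ᵥ A d → Adj H x a₀ → b₀ ∈ᵥ B d → Adj H x b₀
                → ∃ (λ y → parts d y × ¬ Adj H x y) → Split H (insert x P)
  add-splitting cograph anti {a₀} {b₀} a₀∈A xa₀ b₀∈B xb₀ (y , y∈P , x≁y) = record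
    { A = setOf M? ; B = setOf X?
    ; cover = λ { z (inj₁ refl) → inj₂ (∈-setOf⁺ X? (inj₁ refl))
                ; z (inj₂ z∈P) → side z (cover d z z∈P) (adj? H x z) }
    ; A⊆P = λ z → inj₂ ∘ parts⇒P d ∘ proj₁ ∘ ∈-setOf⁻ M?
    ; B⊆P = λ z → Sum.map₂ (parts⇒P d ∘ proj₁) ∘ ∈-setOf⁻ X?
    ; disjoint = λ z z∈M z∈X → excl (∈-setOf⁻ M? z∈M) (∈-setOf⁻ X? z∈X)
    ; A-inhabited = y , ∈-setOf⁺ M? (y∈P , x≁y)
    ; B-inhabited = x , ∈-setOf⁺ X? (inj₁ refl)
    ; homogeneous = inj₁ λ m p m∈M p∈X → no-edge m p (∈-setOf⁻ M? m∈M) (∈-setOf⁻ X? p∈X) }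
    where
    M X : Fin n → Set
    M z = parts d z × ¬ Adj H x z
    X z = z ≡ x ⊎ (parts d z × Adj H x z)
    M? : Decidable M
    M? z = parts? d z ×-dec ¬? (adj? H x z)
    X? : Decidable X
    X? z = (z ≟ᶠ x) ⊎-dec (parts? d z ×-dec adj? H x z)

    side : ∀ z → parts d z → Dec (Adj H x z) → z ∈ᵥ setOf M? ⊎ z ∈ᵥ setOf X?
    side z z∈P (yes xz) = inj₂ (∈-setOf⁺ X? (inj₂ (z∈P , xz)))
    side z z∈P (no x≁z) = inj₁ (∈-setOf⁺ M? (z∈P , x≁z))

    excl : ∀ {z} → M z → X z → ⊥
    excl (z∈P , _) (inj₁ refl) = x∉P (parts⇒P d z∈P)
    excl (_ , x≁z) (inj₂ (_ , xz)) = x≁z xz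

    no-edge : ∀ m p → M m → X p → ¬ Adj H m p
    no-edge m p (_ , x≁m) (inj₁ refl) mx = x≁m (symm H mx)
    no-edge m p (inj₁ m∈A , x≁m) (inj₂ (inj₁ p∈A , xp)) mp =
      cograph (m , p , x , b₀ , mp , symm H xp , xb₀ , x≁m ∘ symm H , anti m b₀ m∈A b₀∈B , anti p b₀ p∈A b₀∈B)
    no-edge m p (inj₂ m∈B , x≁m) (inj₂ (inj₂ p∈B , xp)) mp =
      cograph (m , p , x , a₀ , mp , symm H xp , xa₀ , x≁m ∘ symm H ,
               anti a₀ m a₀∈A m∈B ∘ symm H , anti a₀ p a₀∈A p∈B ∘ symm H)
    no-edge m p (inj₁ m∈A , _) (inj₂ (inj₂ p∈B , _)) = anti m p m∈A p∈B
    no-edge m p (inj₂ m∈B , _) (inj₂ (inj₁ p∈A , _)) = anti p m p∈A m∈B ∘ symm H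

extend-anticomplete : (H : Graph n) → IsCograph H → {P : Fin n → Set} (d : Split H P)
                    → Anticomplete H (A d) (B d) → ∀ x → ¬ P x → Split H (insert x P)
extend-anticomplete H cograph d anti x x∉P
  with any? (λ a → T? (A d a) ×-dec adj? H x a) | any? (λ b → T? (B d b) ×-dec adj? H x b)
     | any? (λ y → parts? d y ×-dec ¬? (adj? H x y))
... | no x≁A | _ | _ = add-beside-B H d x x∉P anti (λ a a∈A xa → x≁A (a , a∈A , xa))
... | yes _ | no x≁B | _ =
  add-beside-B H (split-swap d) x x∉P (λ b a b∈B a∈A → anti a b a∈A b∈B ∘ symm H) (λ b b∈B xb → x≁B (b , b∈B , xb))
... | yes (_ , a₀∈A , xa₀) | yes (_ , b₀∈B , xb₀) | yes nonneighbour =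
  add-splitting H d x x∉P cograph anti a₀∈A xa₀ b₀∈B xb₀ nonneighbour
... | yes _ | yes _ | no ¬nonneighbour =
  add-apex H d x x∉P λ z z∈P → decidable-stable (adj? H x z) (λ x≁z → ¬nonneighbour (z , cover d z z∈P , x≁z))

-- In a cograph every split of P extends to a split of P ∪ {x}; a complete
-- split is handled in the complement, where it is anticomplete.
extend : (H : Graph n) → IsCograph H → {P : Fin n → Set} → Split H P → ∀ x → ¬ P x → Split H (insert x P)
extend H cograph d x x∉P with homogeneous d
... | inj₁ anti = extend-anticomplete H cograph d anti x x∉P
... | inj₂ comp = split-from-complement
  (extend-anticomplete (complement H) (complement-cograph H cograph) (split-complement d)
    (λ a b a∈A b∈B ab → proj₂ ab (comp a b a∈A b∈B)) x x∉P)

data Shape (H : Graph n) (P : Fin n → Set) : Set where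
  empty     : (∀ z → ¬ P z) → Shape H P
  singleton : ∀ y → P y → (∀ z → P z → z ≡ y) → Shape H P
  split     : Split H P → Shape H P

shape-cong : {H : Graph n} {P Q : Fin n → Set} → (∀ z → Q z → P z) → (∀ z → P z → Q z) → Shape H P → Shape H Q
shape-cong Q⇒P P⇒Q (empty ¬P)            = empty λ z → ¬P z ∘ Q⇒P z
shape-cong Q⇒P P⇒Q (singleton y y∈P uniq) = singleton y (P⇒Q y y∈P) λ z → uniq z ∘ Q⇒P z
shape-cong Q⇒P P⇒Q (split d)              = split (split-cong Q⇒P P⇒Q d)

split-pair : (H : Graph n) → ∀ x y → ¬ x ≡ y → Split H (λ z → z ≡ x ⊎ z ≡ y)
split-pair H x y x≢y = record
  { A = setOf (_≟ᶠ x) ; B = setOf (_≟ᶠ y)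
  ; cover = λ z → Sum.map (∈-setOf⁺ (_≟ᶠ x)) (∈-setOf⁺ (_≟ᶠ y))
  ; A⊆P = λ z → inj₁ ∘ ∈-setOf⁻ (_≟ᶠ x) ; B⊆P = λ z → inj₂ ∘ ∈-setOf⁻ (_≟ᶠ y)
  ; disjoint = λ z z≡x z≡y → x≢y (trans (sym (∈-setOf⁻ (_≟ᶠ x) z≡x)) (∈-setOf⁻ (_≟ᶠ y) z≡y))
  ; A-inhabited = x , ∈-setOf⁺ (_≟ᶠ x) refl ; B-inhabited = y , ∈-setOf⁺ (_≟ᶠ y) refl
  ; homogeneous = homogeneous-pair (adj? H x y) }
  where
  homogeneous-pair : Dec (Adj H x y) → Anticomplete H (setOf (_≟ᶠ x)) (setOf (_≟ᶠ y)) ⊎ Complete H (setOf (_≟ᶠ x)) (setOf (_≟ᶠ y))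
  homogeneous-pair (yes xy) = inj₂ λ a b a≡x b≡y →
    subst₂ (Adj H) (sym (∈-setOf⁻ (_≟ᶠ x) a≡x)) (sym (∈-setOf⁻ (_≟ᶠ y) b≡y)) xy
  homogeneous-pair (no x≁y) = inj₁ λ a b a≡x b≡y →
    x≁y ∘ subst₂ (Adj H) (∈-setOf⁻ (_≟ᶠ x) a≡x) (∈-setOf⁻ (_≟ᶠ y) b≡y)

shape-list : (H : Graph n) → IsCograph H → (L : List (Fin n)) → Shape H (_∈ L)
shape-list H cograph [] = empty λ z ()
shape-list H cograph (x ∷ L) with shape-list H cograph L
... | empty ¬L = singleton x (here refl) λ { z (here z≡x) → z≡x ; z (there z∈L) → ⊥-elim (¬L z z∈L) }
... | singleton y y∈L uniq with x ≟ᶠ y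
...   | yes refl = singleton x (here refl) λ { z (here z≡x) → z≡x ; z (there z∈L) → uniq z z∈L }
...   | no x≢y = split (split-cong (λ { z (here z≡x) → inj₁ z≡x ; z (there z∈L) → inj₂ (uniq z z∈L) })
                                   (λ { z (inj₁ refl) → here refl ; z (inj₂ refl) → there y∈L })
                                   (split-pair H x y x≢y))
shape-list H cograph (x ∷ L) | split d with Any.any? (x ≟ᶠ_) L
... | yes x∈L = split (split-cong (λ { z (here refl) → x∈L ; z (there z∈L) → z∈L }) (λ z → there) d)
... | no x∉L  = split (split-cong (λ { z (here z≡x) → inj₁ z≡x ; z (there z∈L) → inj₂ z∈L })
                                  (λ z → [ (λ { refl → here refl }) , there ])
                                  (extend H cograph d x x∉L))

shape : (H : Graph n) → IsCograph H → (S : VSet n) → Shape H (_∈ᵥ S)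
shape {n} H cograph S =
  shape-cong (λ z z∈S → ∈-filter⁺ (T? ∘ S) (∈-allFin z) z∈S)
             (λ z → proj₂ ∘ ∈-filter⁻ (T? ∘ S) {xs = allFin n})
             (shape-list H cograph (filter (T? ∘ S) (allFin n)))

swap : ℕ → ℕ → ℕ → ℕ
swap a b x with x ≟ a | x ≟ b
... | yes _ | _     = b
... | no _  | yes _ = a
... | no _  | no _  = x

swap-left : ∀ a b → swap a b a ≡ b
swap-left a b with a ≟ a
... | yes _  = refl
... | no a≢a = ⊥-elim (a≢a refl)

swap-right : ∀ a b → swap a b b ≡ a
swap-right a b with b ≟ a | b ≟ b
... | yes refl | _     = refl
... | no _     | yes _ = refl
... | no _     | no b≢b = ⊥-elim (b≢b refl)

swap-other : ∀ a b x → ¬ x ≡ a → ¬ x ≡ b → swap a b x ≡ x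
swap-other a b x x≢a x≢b with x ≟ a | x ≟ b
... | yes x≡a | _       = ⊥-elim (x≢a x≡a)
... | no _    | yes x≡b = ⊥-elim (x≢b x≡b)
... | no _    | no _    = refl

swap-involutive : ∀ a b x → swap a b (swap a b x) ≡ x
swap-involutive a b x with x ≟ a | x ≟ b
... | yes refl | _        = swap-right a b
... | no _     | yes refl = swap-left a b
... | no x≢a   | no x≢b   = swap-other a b x x≢a x≢b

swap-injective : ∀ a b x y → swap a b x ≡ swap a b y → x ≡ y
swap-injective a b x y eq =
  trans (sym (swap-involutive a b x)) (trans (cong (swap a b) eq) (swap-involutive a b y))

swap-bounded : ∀ {a b K} → a < K → b < K → ∀ x → x < K → swap a b x < K
swap-bounded {a} {b} a<K b<K x x<K with x ≟ a | x ≟ b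
... | yes _ | _     = b<K
... | no _  | yes _ = a<K
... | no _  | no _  = x<K

swap-below-top : ∀ {α K} → α < K → ∀ x → x < K → ¬ x ≡ α → swap α (K ∸ 1) x < K ∸ 1
swap-below-top {α} {suc K} (s≤s α≤K) x (s≤s x≤K) x≢α with x ≟ α | x ≟ K
... | yes x≡α | _        = ⊥-elim (x≢α x≡α)
... | no _    | yes refl = ≤∧≢⇒< α≤K (x≢α ∘ sym)
... | no _    | no x≢K   = ≤∧≢⇒< x≤K x≢K

record Recolouring (K : ℕ) : Set where
  field
    apply       : ℕ → ℕ
    injective   : ∀ x y → apply x ≡ apply y → x ≡ y
    keeps-range : ∀ x → x < K → apply x < K

open Recolouring

identity : ∀ {K} → Recolouring K
identity = record { apply = λ x → x ; injective = λ _ _ eq → eq ; keeps-range = λ _ x<K → x<K }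

transposition : ∀ {K} a b → a < K → b < K → Recolouring K
transposition a b a<K b<K = record
  { apply = swap a b ; injective = swap-injective a b ; keeps-range = swap-bounded a<K b<K }

_∘ʳ_ : ∀ {K} → Recolouring K → Recolouring K → Recolouring K
g ∘ʳ f = record
  { apply = apply g ∘ apply f
  ; injective = λ x y → injective f x y ∘ injective g (apply f x) (apply f y)
  ; keeps-range = λ x → keeps-range g (apply f x) ∘ keeps-range f x }

-- Lid-colourings of the subgraph induced by a vertex set S, with colours in ℕ.
-- All neighbourhoods and colour sets below are taken inside S.
module Induced {n : ℕ} (G : Graph n) where

  Colours : VSet n → (Fin n → Set) → (Fin n → ℕ) → ℕ → Set
  Colours S Q c col = ∃ λ w → w ∈ᵥ S × Q w × c w ≡ col

  Sees : VSet n → (Fin n → ℕ) → Fin n → ℕ → Set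
  Sees S c u = Colours S (InN G u) c

  Uses : VSet n → (Fin n → ℕ) → ℕ → Set
  Uses S c = Colours S (λ _ → ⊤) c

  SameColours : VSet n → (Fin n → ℕ) → Fin n → Fin n → Set
  SameColours S c u v = ∀ col → (Sees S c u col → Sees S c v col) × (Sees S c v col → Sees S c u col)

  SameNbhd : VSet n → Fin n → Fin n → Set
  SameNbhd S u v = ∀ w → w ∈ᵥ S → (InN G u w → InN G v w) × (InN G v w → InN G u w)

  Universal : VSet n → Fin n → Set
  Universal S u = ∀ w → w ∈ᵥ S → InN G u w

  HasUniversal : VSet n → Set
  HasUniversal S = ∃ λ u → u ∈ᵥ S × Universal S u

  hasUniversal? : (S : VSet n) → Dec (HasUniversal S)
  hasUniversal? S = any? λ u → T? (S u) ×-dec all? λ w → T? (S w) →-dec ((w ≟ᶠ u) ⊎-dec adj? G u w)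

  -- The lid condition is stated contrapositively: adjacent vertices with the
  -- same colour set have the same closed neighbourhood.
  record LidColouring (S : VSet n) (c : Fin n → ℕ) (K : ℕ) : Set where
    field
      bounded : ∀ u → u ∈ᵥ S → c u < K
      proper  : ∀ u v → u ∈ᵥ S → v ∈ᵥ S → Adj G u v → ¬ c u ≡ c v
      lid     : ∀ u v → u ∈ᵥ S → v ∈ᵥ S → Adj G u v → SameColours S c u v → SameNbhd S u v

  open LidColouring public

  SaturatedUniversal : VSet n → (Fin n → ℕ) → Set
  SaturatedUniversal S c = ∀ u → u ∈ᵥ S → (∀ col → Uses S c col → Sees S c u col) → Universal S u

  SpareColour : VSet n → (Fin n → ℕ) → ℕ → Set
  SpareColour S c K = HasUniversal S → ∃ λ α → α < K × ¬ Uses S c α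

  lid-weaken : ∀ {S c K K′} → LidColouring S c K → K ≤ K′ → LidColouring S c K′
  lid-weaken χ K≤K′ = record
    { bounded = λ u u∈S → ≤-trans (bounded χ u u∈S) K≤K′ ; proper = proper χ ; lid = lid χ }

  same-colours-sym : ∀ {S c u v} → SameColours S c u v → SameColours S c v u
  same-colours-sym same col = Product.swap (same col)

  same-nbhd-sym : ∀ {S u v} → SameNbhd S u v → SameNbhd S v u
  same-nbhd-sym same w w∈S = Product.swap (same w w∈S)

  universal-same-nbhd : ∀ {S u v} → Universal S u → Universal S v → SameNbhd S u v
  universal-same-nbhd u-univ v-univ w w∈S = (λ _ → v-univ w w∈S) , (λ _ → u-univ w w∈S)

  universal-restrict : ∀ {A S u} → A ⊆ᵥ S → Universal S u → Universal A u
  universal-restrict A⊆S u-univ w = u-univ w ∘ A⊆S w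

  universal-sees-all : ∀ {X c v col} → Universal X v → Uses X c col → Sees X c v col
  universal-sees-all v-univ (w , w∈X , _ , cw) = w , w∈X , v-univ w w∈X , cw

  module _ (f : ℕ → ℕ) (f-injective : ∀ x y → f x ≡ f y → x ≡ y) {S : VSet n} {c : Fin n → ℕ} where

    recolour⁺ : ∀ {Q col} → Colours S Q c col → Colours S Q (f ∘ c) (f col)
    recolour⁺ (w , w∈S , q , cw) = w , w∈S , q , cong f cw

    recolour⁻ : ∀ {Q col} → Colours S Q (f ∘ c) (f col) → Colours S Q c col
    recolour⁻ (w , w∈S , q , fcw) = w , w∈S , q , f-injective _ _ fcw

    recolour-lid : ∀ {K K′} → LidColouring S c K → (∀ u → u ∈ᵥ S → f (c u) < K′) → LidColouring S (f ∘ c) K′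
    recolour-lid χ f∘c<K′ = record
      { bounded = f∘c<K′
      ; proper = λ u v u∈S v∈S uv → proper χ u v u∈S v∈S uv ∘ f-injective _ _
      ; lid = λ u v u∈S v∈S uv same → lid χ u v u∈S v∈S uv λ col →
          (recolour⁻ ∘ proj₁ (same (f col)) ∘ recolour⁺) ,
          (recolour⁻ ∘ proj₂ (same (f col)) ∘ recolour⁺) }

    recolour-saturated : SaturatedUniversal S c → SaturatedUniversal S (f ∘ c)
    recolour-saturated sat u u∈S sees-all =
      sat u u∈S λ col → recolour⁻ ∘ sees-all (f col) ∘ recolour⁺

  uses-swap⁺ : ∀ {X c} a b col → Uses X c (swap a b col) → Uses X (swap a b ∘ c) col
  uses-swap⁺ a b col (w , w∈X , _ , cw) = w , w∈X , _ , trans (cong (swap a b) cw) (swap-involutive a b col)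

  uses-swap⁻ : ∀ {X c} a b col → Uses X (swap a b ∘ c) col → Uses X c (swap a b col)
  uses-swap⁻ a b col (w , w∈X , _ , scw) = w , w∈X , _ , trans (sym (swap-involutive a b _)) (cong (swap a b) scw)

  module Join {S : VSet n} (d : Split G (_∈ᵥ S)) (complete : Complete G (A d) (B d))
              (c₁ c₂ : Fin n → ℕ) (K₁ : ℕ) (c₁<K₁ : ∀ u → u ∈ᵥ A d → c₁ u < K₁) where

    joined : Fin n → ℕ
    joined z = if A d z then c₁ z else K₁ + c₂ z

    joined-A : ∀ {z} → z ∈ᵥ A d → joined z ≡ c₁ z
    joined-A {z} z∈A with A d z
    ... | true = refl

    joined-B : ∀ {z} → z ∈ᵥ B d → joined z ≡ K₁ + c₂ z
    joined-B {z} z∈B with A d z | disjoint d z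
    ... | true  | z∉B = ⊥-elim (z∉B tt z∈B)
    ... | false | _   = refl

    low⁺ : ∀ {Q col} → Colours (A d) Q c₁ col → Colours S Q joined col
    low⁺ (w , w∈A , q , cw) = w , A⊆P d w w∈A , q , trans (joined-A w∈A) cw

    low-bound : ∀ {Q col} → Colours (A d) Q c₁ col → col < K₁
    low-bound (w , w∈A , _ , cw) = subst (_< K₁) cw (c₁<K₁ w w∈A)

    low⁻ : ∀ {Q col} → Colours S Q joined col → col < K₁ → Colours (A d) Q c₁ col
    low⁻ (w , w∈S , q , jw) col<K₁ with cover d w w∈S
    ... | inj₁ w∈A = w , w∈A , q , trans (sym (joined-A w∈A)) jw
    ... | inj₂ w∈B = ⊥-elim (<⇒≱ col<K₁ (subst (K₁ ≤_) (trans (sym (joined-B w∈B)) jw) (m≤m+n K₁ _)))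

    high⁺ : ∀ {Q col} → Colours (B d) Q c₂ col → Colours S Q joined (K₁ + col)
    high⁺ (w , w∈B , q , cw) = w , B⊆P d w w∈B , q , trans (joined-B w∈B) (cong (K₁ +_) cw)

    high⁻ : ∀ {Q col} → Colours S Q joined (K₁ + col) → Colours (B d) Q c₂ col
    high⁻ (w , w∈S , q , jw) with cover d w w∈S
    ... | inj₁ w∈A = ⊥-elim (<⇒≱ (c₁<K₁ w w∈A) (subst (K₁ ≤_) (trans (sym jw) (joined-A w∈A)) (m≤m+n K₁ _)))
    ... | inj₂ w∈B = w , w∈B , q , +-cancelˡ-≡ K₁ _ _ (trans (sym (joined-B w∈B)) jw)

    same-low : ∀ {u v} → SameColours S joined u v → SameColours (A d) c₁ u v
    same-low same col = (λ s → low⁻ (proj₁ (same col) (low⁺ s)) (low-bound s)) ,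
                        (λ s → low⁻ (proj₂ (same col) (low⁺ s)) (low-bound s))

    same-high : ∀ {u v} → SameColours S joined u v → SameColours (B d) c₂ u v
    same-high same col = high⁻ ∘ proj₁ (same (K₁ + col)) ∘ high⁺ , high⁻ ∘ proj₂ (same (K₁ + col)) ∘ high⁺

    -- Each side is complete to the other, so universality and equality of
    -- neighbourhoods inside one side lift to S.
    universal-from-A : ∀ {u} → u ∈ᵥ A d → Universal (A d) u → Universal S u
    universal-from-A {u} u∈A u-univ w w∈S = [ u-univ w , inj₂ ∘ complete u w u∈A ] (cover d w w∈S)

    universal-from-B : ∀ {u} → u ∈ᵥ B d → Universal (B d) u → Universal S u
    universal-from-B {u} u∈B u-univ w w∈S =
      [ (λ w∈A → inj₂ (symm G (complete w u w∈A u∈B))) , u-univ w ] (cover d w w∈S)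

    same-nbhd-from-A : ∀ {u v} → u ∈ᵥ A d → v ∈ᵥ A d → SameNbhd (A d) u v → SameNbhd S u v
    same-nbhd-from-A {u} {v} u∈A v∈A same w w∈S with cover d w w∈S
    ... | inj₁ w∈A = same w w∈A
    ... | inj₂ w∈B = (λ _ → inj₂ (complete v w v∈A w∈B)) , (λ _ → inj₂ (complete u w u∈A w∈B))

    same-nbhd-from-B : ∀ {u v} → u ∈ᵥ B d → v ∈ᵥ B d → SameNbhd (B d) u v → SameNbhd S u v
    same-nbhd-from-B {u} {v} u∈B v∈B same w w∈S with cover d w w∈S
    ... | inj₂ w∈B = same w w∈B
    ... | inj₁ w∈A = (λ _ → inj₂ (symm G (complete w v w∈A v∈B))) , (λ _ → inj₂ (symm G (complete w u w∈A u∈B)))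

    -- If u ∈ A and v ∈ B have the same colour set, then u sees every colour
    -- of A (as v does) and v sees every colour of B (as u does).
    cross-saturated-A : ∀ {u v} → u ∈ᵥ A d → v ∈ᵥ B d → SameColours S joined u v
                      → ∀ col → Uses (A d) c₁ col → Sees (A d) c₁ u col
    cross-saturated-A u∈A v∈B same col =
      proj₂ (same-low same col) ∘ universal-sees-all (λ w w∈A → inj₂ (symm G (complete w _ w∈A v∈B)))

    cross-saturated-B : ∀ {u v} → u ∈ᵥ A d → v ∈ᵥ B d → SameColours S joined u v
                      → ∀ col → Uses (B d) c₂ col → Sees (B d) c₂ v col
    cross-saturated-B u∈A v∈B same col =
      proj₁ (same-high same col) ∘ universal-sees-all (λ w w∈B → inj₂ (complete _ w u∈A w∈B))

    joined-colouring : ∀ {K₂} → LidColouring (A d) c₁ K₁ → LidColouring (B d) c₂ K₂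
                     → SaturatedUniversal (A d) c₁ → ¬ HasUniversal (A d) ⊎ SaturatedUniversal (B d) c₂
                     → LidColouring S joined (K₁ + K₂)
    joined-colouring {K₂} χ₁ χ₂ sat₁ sat₂ = record { bounded = bound ; proper = prop ; lid = lid-cases }
      where
      bound : ∀ u → u ∈ᵥ S → joined u < K₁ + K₂
      bound u u∈S with cover d u u∈S
      ... | inj₁ u∈A = subst (_< K₁ + K₂) (sym (joined-A u∈A)) (<-≤-trans (c₁<K₁ u u∈A) (m≤m+n K₁ K₂))
      ... | inj₂ u∈B = subst (_< K₁ + K₂) (sym (joined-B u∈B)) (+-monoʳ-< K₁ (bounded χ₂ u u∈B))

      A≢B : ∀ {u v} → u ∈ᵥ A d → v ∈ᵥ B d → ¬ joined u ≡ joined v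
      A≢B {u} u∈A v∈B eq = <⇒≱ (c₁<K₁ u u∈A)
        (subst (K₁ ≤_) (trans (sym (joined-B v∈B)) (trans (sym eq) (joined-A u∈A))) (m≤m+n K₁ _))

      prop : ∀ u v → u ∈ᵥ S → v ∈ᵥ S → Adj G u v → ¬ joined u ≡ joined v
      prop u v u∈S v∈S uv with cover d u u∈S | cover d v v∈S
      ... | inj₁ u∈A | inj₁ v∈A = proper χ₁ u v u∈A v∈A uv ∘ λ eq → trans (sym (joined-A u∈A)) (trans eq (joined-A v∈A))
      ... | inj₂ u∈B | inj₂ v∈B = proper χ₂ u v u∈B v∈B uv ∘ λ eq →
                                   +-cancelˡ-≡ K₁ _ _ (trans (sym (joined-B u∈B)) (trans eq (joined-B v∈B)))
      ... | inj₁ u∈A | inj₂ v∈B = A≢B u∈A v∈B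
      ... | inj₂ u∈B | inj₁ v∈A = A≢B v∈A u∈B ∘ sym

      -- u ∈ A and v ∈ B with equal colour sets are both universal in S.
      cross : ∀ {u v} → u ∈ᵥ A d → v ∈ᵥ B d → SameColours S joined u v → SameNbhd S u v
      cross {u} {v} u∈A v∈B same =
        universal-same-nbhd (universal-from-A u∈A u-univ) (universal-from-B v∈B (v-univ sat₂))
        where
        u-univ : Universal (A d) u
        u-univ = sat₁ u u∈A (cross-saturated-A u∈A v∈B same)
        v-univ : ¬ HasUniversal (A d) ⊎ SaturatedUniversal (B d) c₂ → Universal (B d) v
        v-univ (inj₁ no-universal) = ⊥-elim (no-universal (u , u∈A , u-univ))
        v-univ (inj₂ sat)          = sat v v∈B (cross-saturated-B u∈A v∈B same)

      lid-cases : ∀ u v → u ∈ᵥ S → v ∈ᵥ S → Adj G u v → SameColours S joined u v → SameNbhd S u v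
      lid-cases u v u∈S v∈S uv same with cover d u u∈S | cover d v v∈S
      ... | inj₁ u∈A | inj₁ v∈A = same-nbhd-from-A u∈A v∈A (lid χ₁ u v u∈A v∈A uv (same-low same))
      ... | inj₂ u∈B | inj₂ v∈B = same-nbhd-from-B u∈B v∈B (lid χ₂ u v u∈B v∈B uv (same-high same))
      ... | inj₁ u∈A | inj₂ v∈B = cross u∈A v∈B same
      ... | inj₂ u∈B | inj₁ v∈A = same-nbhd-sym (cross v∈A u∈B (same-colours-sym same))

    joined-saturated : SaturatedUniversal (A d) c₁ → SaturatedUniversal (B d) c₂ → SaturatedUniversal S joined
    joined-saturated sat₁ sat₂ u u∈S sees-all with cover d u u∈S
    ... | inj₁ u∈A = universal-from-A u∈A (sat₁ u u∈A λ col used → low⁻ (sees-all col (low⁺ used)) (low-bound used))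
    ... | inj₂ u∈B = universal-from-B u∈B (sat₂ u u∈B λ col used → high⁻ (sees-all (K₁ + col) (high⁺ used)))

    -- A vertex universal in S is universal in its side, whose spare colour
    -- (shifted if the side is B) stays unused on S.
    joined-spare : ∀ {K₂} → SpareColour (A d) c₁ K₁ → SpareColour (B d) c₂ K₂ → SpareColour S joined (K₁ + K₂)
    joined-spare {K₂} spare₁ spare₂ (u , u∈S , u-univ) with cover d u u∈S
    ... | inj₁ u∈A =
      let (α , α<K₁ , α-unused) = spare₁ (u , u∈A , universal-restrict (A⊆P d) u-univ)
      in α , <-≤-trans α<K₁ (m≤m+n K₁ K₂) , λ used → α-unused (low⁻ used α<K₁)
    ... | inj₂ u∈B =
      let (β , β<K₂ , β-unused) = spare₂ (u , u∈B , universal-restrict (B⊆P d) u-univ)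
      in K₁ + β , +-monoʳ-< K₁ β<K₂ , β-unused ∘ high⁻

  sees⇒uses : ∀ {X c u col} → Sees X c u col → Uses X c col
  sees⇒uses (w , w∈X , _ , cw) = w , w∈X , tt , cw

  module Union {S : VSet n} (d : Split G (_∈ᵥ S)) (anticomplete : Anticomplete G (A d) (B d))
               (c₁ c₂ : Fin n → ℕ) where

    united : Fin n → ℕ
    united z = if A d z then c₁ z else c₂ z

    united-A : ∀ {z} → z ∈ᵥ A d → united z ≡ c₁ z
    united-A {z} z∈A with A d z
    ... | true = refl

    united-B : ∀ {z} → z ∈ᵥ B d → united z ≡ c₂ z
    united-B {z} z∈B with A d z | disjoint d z
    ... | true  | z∉B = ⊥-elim (z∉B tt z∈B)
    ... | false | _   = refl

    nbhd-in-A : ∀ {u w} → u ∈ᵥ A d → w ∈ᵥ S → InN G u w → w ∈ᵥ A d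
    nbhd-in-A {u} {w} u∈A w∈S uw with cover d w w∈S | uw
    ... | inj₁ w∈A | _        = w∈A
    ... | inj₂ w∈B | inj₁ refl = ⊥-elim (disjoint d u u∈A w∈B)
    ... | inj₂ w∈B | inj₂ adj  = ⊥-elim (anticomplete u w u∈A w∈B adj)

    nbhd-in-B : ∀ {u w} → u ∈ᵥ B d → w ∈ᵥ S → InN G u w → w ∈ᵥ B d
    nbhd-in-B {u} {w} u∈B w∈S uw with cover d w w∈S | uw
    ... | inj₂ w∈B | _        = w∈B
    ... | inj₁ w∈A | inj₁ refl = ⊥-elim (disjoint d u w∈A u∈B)
    ... | inj₁ w∈A | inj₂ adj  = ⊥-elim (anticomplete w u w∈A u∈B (symm G adj))

    side-A⁺ : ∀ {Q col} → Colours (A d) Q c₁ col → Colours S Q united col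
    side-A⁺ (w , w∈A , q , cw) = w , A⊆P d w w∈A , q , trans (united-A w∈A) cw

    side-B⁺ : ∀ {Q col} → Colours (B d) Q c₂ col → Colours S Q united col
    side-B⁺ (w , w∈B , q , cw) = w , B⊆P d w w∈B , q , trans (united-B w∈B) cw

    sees-A⁻ : ∀ {u col} → u ∈ᵥ A d → Sees S united u col → Sees (A d) c₁ u col
    sees-A⁻ u∈A (w , w∈S , uw , cw) = let w∈A = nbhd-in-A u∈A w∈S uw in w , w∈A , uw , trans (sym (united-A w∈A)) cw

    sees-B⁻ : ∀ {u col} → u ∈ᵥ B d → Sees S united u col → Sees (B d) c₂ u col
    sees-B⁻ u∈B (w , w∈S , uw , cw) = let w∈B = nbhd-in-B u∈B w∈S uw in w , w∈B , uw , trans (sym (united-B w∈B)) cw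

    same-nbhd-from-A : ∀ {u v} → u ∈ᵥ A d → v ∈ᵥ A d → SameNbhd (A d) u v → SameNbhd S u v
    same-nbhd-from-A u∈A v∈A same w w∈S with cover d w w∈S
    ... | inj₁ w∈A = same w w∈A
    ... | inj₂ w∈B = (λ uw → ⊥-elim (disjoint d w (nbhd-in-A u∈A w∈S uw) w∈B)) ,
                     (λ vw → ⊥-elim (disjoint d w (nbhd-in-A v∈A w∈S vw) w∈B))

    same-nbhd-from-B : ∀ {u v} → u ∈ᵥ B d → v ∈ᵥ B d → SameNbhd (B d) u v → SameNbhd S u v
    same-nbhd-from-B u∈B v∈B same w w∈S with cover d w w∈S
    ... | inj₂ w∈B = same w w∈B
    ... | inj₁ w∈A = (λ uw → ⊥-elim (disjoint d w w∈A (nbhd-in-B u∈B w∈S uw))) ,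
                     (λ vw → ⊥-elim (disjoint d w w∈A (nbhd-in-B v∈B w∈S vw)))

    -- Edges and closed neighbourhoods stay inside one side, so both
    -- conditions are checked there.
    united-colouring : ∀ {K} → LidColouring (A d) c₁ K → LidColouring (B d) c₂ K → LidColouring S united K
    united-colouring {K} χ₁ χ₂ = record { bounded = bound ; proper = prop ; lid = lid-cases }
      where
      bound : ∀ u → u ∈ᵥ S → united u < K
      bound u u∈S with cover d u u∈S
      ... | inj₁ u∈A = subst (_< K) (sym (united-A u∈A)) (bounded χ₁ u u∈A)
      ... | inj₂ u∈B = subst (_< K) (sym (united-B u∈B)) (bounded χ₂ u u∈B)

      prop : ∀ u v → u ∈ᵥ S → v ∈ᵥ S → Adj G u v → ¬ united u ≡ united v
      prop u v u∈S v∈S uv with cover d u u∈S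
      ... | inj₁ u∈A = let v∈A = nbhd-in-A u∈A v∈S (inj₂ uv) in
        proper χ₁ u v u∈A v∈A uv ∘ λ eq → trans (sym (united-A u∈A)) (trans eq (united-A v∈A))
      ... | inj₂ u∈B = let v∈B = nbhd-in-B u∈B v∈S (inj₂ uv) in
        proper χ₂ u v u∈B v∈B uv ∘ λ eq → trans (sym (united-B u∈B)) (trans eq (united-B v∈B))

      lid-cases : ∀ u v → u ∈ᵥ S → v ∈ᵥ S → Adj G u v → SameColours S united u v → SameNbhd S u v
      lid-cases u v u∈S v∈S uv same with cover d u u∈S
      ... | inj₁ u∈A = let v∈A = nbhd-in-A u∈A v∈S (inj₂ uv) in
        same-nbhd-from-A u∈A v∈A (lid χ₁ u v u∈A v∈A uv λ col →
          sees-A⁻ v∈A ∘ proj₁ (same col) ∘ side-A⁺ , sees-A⁻ u∈A ∘ proj₂ (same col) ∘ side-A⁺)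
      ... | inj₂ u∈B = let v∈B = nbhd-in-B u∈B v∈S (inj₂ uv) in
        same-nbhd-from-B u∈B v∈B (lid χ₂ u v u∈B v∈B uv λ col →
          sees-B⁻ v∈B ∘ proj₁ (same col) ∘ side-B⁺ , sees-B⁻ u∈B ∘ proj₂ (same col) ∘ side-B⁺)

    -- A saturated vertex u of A is universal in A, hence (by separation) some
    -- colour of B is missing from A; but u sees it, and u only sees colours of A.
    united-saturated : SaturatedUniversal (A d) c₁ → SaturatedUniversal (B d) c₂
                     → (HasUniversal (A d) → ∃ λ β → Uses (B d) c₂ β × ¬ Uses (A d) c₁ β)
                     → (HasUniversal (B d) → ∃ λ β → Uses (A d) c₁ β × ¬ Uses (B d) c₂ β)
                     → SaturatedUniversal S united
    united-saturated sat₁ sat₂ separated-A separated-B u u∈S sees-all with cover d u u∈S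
    ... | inj₁ u∈A =
      let u-univ = sat₁ u u∈A λ col → sees-A⁻ u∈A ∘ sees-all col ∘ side-A⁺
          (β , β-in-B , β-not-in-A) = separated-A (u , u∈A , u-univ)
      in ⊥-elim (β-not-in-A (sees⇒uses (sees-A⁻ u∈A (sees-all β (side-B⁺ β-in-B)))))
    ... | inj₂ u∈B =
      let u-univ = sat₂ u u∈B λ col → sees-B⁻ u∈B ∘ sees-all col ∘ side-B⁺
          (β , β-in-A , β-not-in-B) = separated-B (u , u∈B , u-univ)
      in ⊥-elim (β-not-in-B (sees⇒uses (sees-B⁻ u∈B (sees-all β (side-A⁺ β-in-A)))))

    -- A disconnected S has no universal vertex.
    united-spare : ∀ {K} → SpareColour S united K
    united-spare (u , u∈S , u-univ) with cover d u u∈S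
    ... | inj₁ u∈A = let (b , b∈B) = B-inhabited d in
      ⊥-elim (disjoint d b (nbhd-in-A u∈A (B⊆P d b b∈B) (u-univ b (B⊆P d b b∈B))) b∈B)
    ... | inj₂ u∈B = let (a , a∈A) = A-inhabited d in
      ⊥-elim (disjoint d a a∈A (nbhd-in-B u∈B (A⊆P d a a∈A) (u-univ a (A⊆P d a a∈A))))

  -- Separation, step 1: if Y has a universal vertex, a spare colour of Y can
  -- be exchanged with a prescribed colour γ, which then no longer occurs on Y.
  avoid-colour : ∀ {Y c K γ} → γ < K → SpareColour Y c K
               → Σ (Recolouring K) λ f → HasUniversal Y → ¬ Uses Y (apply f ∘ c) γ
  avoid-colour {Y} {c} {K} {γ} γ<K spare with hasUniversal? Y
  ... | no ¬universal = identity , λ universal → ⊥-elim (¬universal universal)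
  ... | yes universal =
    let (β , β<K , β-unused) = spare universal in
    transposition β γ β<K γ<K ,
    λ _ γ-used → β-unused (subst (Uses Y c) (swap-right β γ) (uses-swap⁻ β γ γ γ-used))

  -- Separation, step 2: if X has a universal vertex, a colour α missing on X
  -- can be moved onto the vertex b₀ ∈ Y; a colour γ used on X is neither α
  -- nor (if it is absent from Y) the old colour of b₀, so it stays absent from Y.
  show-colour : ∀ {X Y c₁ c K γ b₀} → b₀ ∈ᵥ Y → c b₀ < K → SpareColour X c₁ K → Uses X c₁ γ
              → Σ (Recolouring K) λ g → (HasUniversal X → ∃ λ β → Uses Y (apply g ∘ c) β × ¬ Uses X c₁ β)
                                        × (¬ Uses Y c γ → ¬ Uses Y (apply g ∘ c) γ)
  show-colour {X} {Y} {c₁} {c} {K} {γ} {b₀} b₀∈Y cb₀<K spare γ-used with hasUniversal? X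
  ... | no ¬universal = identity , (λ universal → ⊥-elim (¬universal universal)) , λ γ-absent → γ-absent
  ... | yes universal with spare universal
  ...   | α , α<K , α-unused =
    transposition (c b₀) α cb₀<K α<K ,
    (λ _ → α , uses-swap⁺ (c b₀) α α (subst (Uses Y c) (sym (swap-right (c b₀) α)) (b₀ , b₀∈Y , tt , refl)) , α-unused) ,
    λ γ-absent γ-used → γ-absent (subst (Uses Y c) (swap-other (c b₀) α γ (γ≢cb₀ γ-absent) γ≢α) (uses-swap⁻ (c b₀) α γ γ-used))
    where
    γ≢cb₀ : ¬ Uses Y c γ → ¬ γ ≡ c b₀
    γ≢cb₀ γ-absent eq = γ-absent (b₀ , b₀∈Y , tt , sym eq)
    γ≢α : ¬ γ ≡ α
    γ≢α eq = α-unused (subst (Uses X c₁) eq γ-used)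

  separate : ∀ {X Y c₁ c₂ K} → (∀ u → u ∈ᵥ X → c₁ u < K) → (∀ u → u ∈ᵥ Y → c₂ u < K)
           → SpareColour X c₁ K → SpareColour Y c₂ K → ∃ (_∈ᵥ X) → ∃ (_∈ᵥ Y)
           → Σ (Recolouring K) λ f →
               (HasUniversal X → ∃ λ β → Uses Y (apply f ∘ c₂) β × ¬ Uses X c₁ β) ×
               (HasUniversal Y → ∃ λ β → Uses X c₁ β × ¬ Uses Y (apply f ∘ c₂) β)
  separate {c₁ = c₁} c₁<K c₂<K spare₁ spare₂ (a₀ , a₀∈X) (b₀ , b₀∈Y) with avoid-colour (c₁<K a₀ a₀∈X) spare₂
  ... | f , avoids with show-colour b₀∈Y (keeps-range f _ (c₂<K b₀ b₀∈Y)) spare₁ (a₀ , a₀∈X , tt , refl)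
  ...   | g , shows , keeps = g ∘ʳ f , shows , λ universal → c₁ a₀ , (a₀ , a₀∈X , tt , refl) , keeps (avoids universal)

  -- The induction invariant for a vertex set S and a number k (the size of a
  -- clique of S): a lid-colouring with 2k − 1 colours, and a lid-colouring
  -- with 2k colours in which saturated vertices are universal and a universal
  -- vertex leaves a colour unused.
  record Colourings (S : VSet n) (k : ℕ) : Set where
    field
      narrow           : Fin n → ℕ
      narrow-colouring : LidColouring S narrow (2 * k ∸ 1)
      wide             : Fin n → ℕ
      wide-colouring   : LidColouring S wide (2 * k)
      wide-saturated   : SaturatedUniversal S wide
      wide-spare       : SpareColour S wide (2 * k)

  open Colourings public

  colourings-weaken : ∀ {S k k′} → k ≤ k′ → Colourings S k → Colourings S k′
  colourings-weaken k≤k′ C = record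
    { narrow = narrow C
    ; narrow-colouring = lid-weaken (narrow-colouring C) (∸-monoˡ-≤ 1 (*-monoʳ-≤ 2 k≤k′))
    ; wide = wide C
    ; wide-colouring = lid-weaken (wide-colouring C) (*-monoʳ-≤ 2 k≤k′)
    ; wide-saturated = wide-saturated C
    ; wide-spare = λ universal → let (α , α<2k , α-unused) = wide-spare C universal in
                                 α , <-≤-trans α<2k (*-monoʳ-≤ 2 k≤k′) , α-unused }

  colourings-singleton : ∀ {S y} → y ∈ᵥ S → (∀ z → z ∈ᵥ S → z ≡ y) → Colourings S 1
  colourings-singleton {S} {y} y∈S only-y = record
    { narrow = λ _ → 0 ; narrow-colouring = constant (s≤s z≤n)
    ; wide = λ _ → 0 ; wide-colouring = constant (s≤s z≤n)
    ; wide-saturated = λ u u∈S _ w w∈S → inj₁ (trans (only-y w w∈S) (sym (only-y u u∈S)))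
    ; wide-spare = λ _ → 1 , s≤s (s≤s z≤n) , λ () }
    where
    no-edge : ∀ u v → u ∈ᵥ S → v ∈ᵥ S → ¬ Adj G u v
    no-edge u v u∈S v∈S uv = irrefl G (subst (Adj G u) (trans (only-y v v∈S) (sym (only-y u u∈S))) uv)
    constant : ∀ {K} → 0 < K → LidColouring S (λ _ → 0) K
    constant 0<K = record
      { bounded = λ _ _ → 0<K
      ; proper = λ u v u∈S v∈S uv _ → no-edge u v u∈S v∈S uv
      ; lid = λ u v u∈S v∈S uv _ → ⊥-elim (no-edge u v u∈S v∈S uv) }

  -- Anticomplete split: colour the sides independently with the same number
  -- of colours, after separating the colour sets of the wide colourings.
  colourings-union : ∀ {S k} (d : Split G (_∈ᵥ S)) → Anticomplete G (A d) (B d)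
                   → Colourings (A d) k → Colourings (B d) k → Colourings S k
  colourings-union d anticomplete C₁ C₂
    with separate (bounded (wide-colouring C₁)) (bounded (wide-colouring C₂))
                  (wide-spare C₁) (wide-spare C₂) (A-inhabited d) (B-inhabited d)
  ... | f , separated-A , separated-B = record
    { narrow = U.united
    ; narrow-colouring = U.united-colouring (narrow-colouring C₁) (narrow-colouring C₂)
    ; wide = V.united
    ; wide-colouring = V.united-colouring (wide-colouring C₁)
        (recolour-lid (apply f) (injective f) (wide-colouring C₂)
          λ u u∈B → keeps-range f _ (bounded (wide-colouring C₂) u u∈B))
    ; wide-saturated = V.united-saturated (wide-saturated C₁)
        (recolour-saturated (apply f) (injective f) (wide-saturated C₂)) separated-A separated-B
    ; wide-spare = V.united-spare }
    where
    module U = Union d anticomplete (narrow C₁) (narrow C₂)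
    module V = Union d anticomplete (wide C₁) (apply f ∘ wide C₂)

  -- Wide: wide₁ below wide₂, 2k₁ + 2k₂ colours.  Narrow: if A has a universal
  -- vertex, its wide colouring has a spare colour, which is moved to the top
  -- and then dropped, giving 2k₁ − 1 + 2k₂ colours; otherwise the lid
  -- condition across the split needs no saturation in B and wide₁ below
  -- narrow₂ gives 2k₁ + 2k₂ − 1 colours.
  colourings-join : ∀ {S k₁ k₂} (d : Split G (_∈ᵥ S)) → Complete G (A d) (B d) → 1 ≤ k₁ → 1 ≤ k₂
                  → Colourings (A d) k₁ → Colourings (B d) k₂ → Colourings S (k₁ + k₂)
  colourings-join {S} {k₁} {k₂} d complete 1≤k₁ 1≤k₂ C₁ C₂ = record
    { narrow = proj₁ narrow-join
    ; narrow-colouring = proj₂ narrow-join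
    ; wide = W.joined
    ; wide-colouring = lid-weaken
        (W.joined-colouring (wide-colouring C₁) (wide-colouring C₂) (wide-saturated C₁) (inj₂ (wide-saturated C₂)))
        (≤-reflexive (sym double-sum))
    ; wide-saturated = W.joined-saturated (wide-saturated C₁) (wide-saturated C₂)
    ; wide-spare = subst (SpareColour S W.joined) (sym double-sum) (W.joined-spare (wide-spare C₁) (wide-spare C₂)) }
    where
    double-sum : 2 * (k₁ + k₂) ≡ 2 * k₁ + 2 * k₂
    double-sum = *-distribˡ-+ 2 k₁ k₂

    1≤double : ∀ {k} → 1 ≤ k → 1 ≤ 2 * k
    1≤double {k} 1≤k = ≤-trans 1≤k (m≤m+n k _)

    module W = Join d complete (wide C₁) (wide C₂) (2 * k₁) (bounded (wide-colouring C₁))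

    narrow-join : Σ (Fin n → ℕ) λ c → LidColouring S c (2 * (k₁ + k₂) ∸ 1)
    narrow-join with hasUniversal? (A d)
    ... | no ¬universal =
      W′.joined ,
      lid-weaken (W′.joined-colouring (wide-colouring C₁) (narrow-colouring C₂) (wide-saturated C₁) (inj₁ ¬universal))
                 (≤-reflexive (trans (sym (+-∸-assoc (2 * k₁) (1≤double 1≤k₂))) (cong (_∸ 1) (sym double-sum))))
      where
      module W′ = Join d complete (wide C₁) (narrow C₂) (2 * k₁) (bounded (wide-colouring C₁))
    ... | yes universal with wide-spare C₁ universal
    ...   | α , α<2k₁ , α-unused =
      J.joined ,
      lid-weaken (J.joined-colouring freed-colouring (wide-colouring C₂)
                   (recolour-saturated (swap α top) (swap-injective α top) (wide-saturated C₁))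
                   (inj₂ (wide-saturated C₂)))
                 (≤-reflexive (trans (sym (+-∸-comm (2 * k₂) (1≤double 1≤k₁))) (cong (_∸ 1) (sym double-sum))))
      where
      top : ℕ
      top = 2 * k₁ ∸ 1
      freed-colouring : LidColouring (A d) (swap α top ∘ wide C₁) top
      freed-colouring = recolour-lid (swap α top) (swap-injective α top) (wide-colouring C₁) λ u u∈A →
        swap-below-top α<2k₁ (wide C₁ u) (bounded (wide-colouring C₁) u u∈A) (λ eq → α-unused (u , u∈A , tt , eq))
      module J = Join d complete (swap α top ∘ wide C₁) (wide C₂) top (bounded freed-colouring)

  record Clique (S : VSet n) : Set where
    field
      members   : VSet n
      members⊆S : members ⊆ᵥ S
      adjacent  : ∀ u v → u ∈ᵥ members → v ∈ᵥ members → ¬ u ≡ v → Adj G u v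
      inhabited : ∃ (_∈ᵥ members)

    order : ℕ
    order = size members

    1≤order : 1 ≤ order
    1≤order = size-nonempty members (proj₁ inhabited) (proj₂ inhabited)

  open Clique public

  clique-widen : ∀ {A S} → A ⊆ᵥ S → Clique A → Clique S
  clique-widen A⊆S K = record
    { members = members K ; members⊆S = λ z → A⊆S z ∘ members⊆S K z
    ; adjacent = adjacent K ; inhabited = inhabited K }

  clique-join : ∀ {S} (d : Split G (_∈ᵥ S)) → Complete G (A d) (B d) → Clique (A d) → Clique (B d) → Clique S
  clique-join d complete K₁ K₂ = record
    { members = members K₁ ∪ᵥ members K₂
    ; members⊆S = λ z → [ A⊆P d z ∘ members⊆S K₁ z , B⊆P d z ∘ members⊆S K₂ z ] ∘ Equivalence.to T-∨
    ; adjacent = λ u v u∈K v∈K u≢v → adjacent-cases u v (Equivalence.to T-∨ u∈K) (Equivalence.to T-∨ v∈K) u≢v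
    ; inhabited = Product.map₂ (Equivalence.from T-∨ ∘ inj₁) (inhabited K₁) }
    where
    adjacent-cases : ∀ u v → u ∈ᵥ members K₁ ⊎ u ∈ᵥ members K₂ → v ∈ᵥ members K₁ ⊎ v ∈ᵥ members K₂ → ¬ u ≡ v → Adj G u v
    adjacent-cases u v (inj₁ u∈K₁) (inj₁ v∈K₁) = adjacent K₁ u v u∈K₁ v∈K₁
    adjacent-cases u v (inj₂ u∈K₂) (inj₂ v∈K₂) = adjacent K₂ u v u∈K₂ v∈K₂
    adjacent-cases u v (inj₁ u∈K₁) (inj₂ v∈K₂) _ = complete u v (members⊆S K₁ u u∈K₁) (members⊆S K₂ v v∈K₂)
    adjacent-cases u v (inj₂ u∈K₂) (inj₁ v∈K₁) _ = symm G (complete v u (members⊆S K₁ v v∈K₁) (members⊆S K₂ u u∈K₂))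

  clique-join-order : ∀ {S} (d : Split G (_∈ᵥ S)) (complete : Complete G (A d) (B d)) (K₁ : Clique (A d)) (K₂ : Clique (B d))
                    → order (clique-join d complete K₁ K₂) ≡ order K₁ + order K₂
  clique-join-order d complete K₁ K₂ = size-∪ (members K₁) (members K₂) λ z z∈K₁ z∈K₂ →
    disjoint d z (members⊆S K₁ z z∈K₁) (members⊆S K₂ z z∈K₂)

  colourings-split : ∀ {S} (d : Split G (_∈ᵥ S))
                   → Σ (Clique (A d)) (Colourings (A d) ∘ order) → Σ (Clique (B d)) (Colourings (B d) ∘ order)
                   → Σ (Clique S) (Colourings S ∘ order)
  colourings-split {S} d (K₁ , C₁) (K₂ , C₂) with homogeneous d
  ... | inj₂ complete =
    clique-join d complete K₁ K₂ ,
    subst (Colourings S) (sym (clique-join-order d complete K₁ K₂))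
          (colourings-join d complete (1≤order K₁) (1≤order K₂) C₁ C₂)
  ... | inj₁ anticomplete with order K₁ ≤? order K₂
  ...   | yes k₁≤k₂ = clique-widen (B⊆P d) K₂ , colourings-union d anticomplete (colourings-weaken k₁≤k₂ C₁) C₂
  ...   | no k₁≰k₂  = clique-widen (A⊆P d) K₁ ,
                      colourings-union d anticomplete C₁ (colourings-weaken (<⇒≤ (≰⇒> k₁≰k₂)) C₂)

  colourings : IsCograph G → (m : ℕ) (S : VSet n) → size S ≤ m → ∃ (_∈ᵥ S) → Σ (Clique S) (Colourings S ∘ order)
  colourings cograph zero S size≤0 (x , x∈S) = ⊥-elim (1+n≰n (≤-trans (size-nonempty S x x∈S) size≤0))
  colourings cograph (suc m) S size≤m (x , x∈S) with shape G cograph S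
  ... | empty ∅ = ⊥-elim (∅ x x∈S)
  ... | singleton y y∈S only-y =
    K , colourings-weaken (1≤order K) (colourings-singleton y∈S only-y)
    where
    K : Clique S
    K = record { members = S ; members⊆S = λ _ z∈S → z∈S ; inhabited = y , y∈S
               ; adjacent = λ u v u∈S v∈S u≢v → ⊥-elim (u≢v (trans (only-y u u∈S) (sym (only-y v v∈S)))) }
  ... | split d =
    let (a , a∈A) = A-inhabited d ; (b , b∈B) = B-inhabited d in
    colourings-split d (recurse (A⊆P d) b (B⊆P d b b∈B) (λ b∈A → disjoint d b b∈A b∈B) (A-inhabited d))
                       (recurse (B⊆P d) a (A⊆P d a a∈A) (disjoint d a a∈A) (B-inhabited d))
    where
    -- a side misses a vertex y of S, so it is strictly smaller than S
    recurse : ∀ {X} → X ⊆ᵥ S → ∀ y → y ∈ᵥ S → ¬ y ∈ᵥ X → ∃ (_∈ᵥ X) → Σ (Clique X) (Colourings X ∘ order)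
    recurse X⊆S y y∈S y∉X = colourings cograph m _ (≤-pred (≤-trans (size-strict X⊆S y y∈S y∉X) size≤m))

everything : VSet n
everything _ = true

module _ {n : ℕ} (G : Graph n) where
  open Induced G

  lid-colourable : ∀ {c K} → LidColouring everything c K → LidColorableWith G K
  lid-colourable {c} {K} χ = colouring , proper′ , lid′
    where
    colouring : Fin n → Fin K
    colouring u = fromℕ< (bounded χ u tt)

    colour-eq : ∀ {u v} → colouring u ≡ colouring v → c u ≡ c v
    colour-eq eq = trans (sym (toℕ-fromℕ< _)) (trans (cong toℕ eq) (toℕ-fromℕ< _))

    proper′ : IsProperColoring G colouring
    proper′ u v uv = proper χ u v tt tt uv ∘ colour-eq

    sees : ∀ {u v} → (∀ col → ColorIn G colouring u col → ColorIn G colouring v col)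
         → ∀ col → Sees everything c u col → Sees everything c v col
    sees same col (w , _ , uw , cw) =
      let (w′ , vw′ , eq) = same (colouring w) (w , uw , refl) in w′ , tt , vw′ , trans (colour-eq eq) cw

    lid′ : ∀ u v → Adj G u v → ¬ SameClosedNbhd G u v → ¬ SameColorSet G colouring u v
    lid′ u v uv different same =
      different λ w → lid χ u v tt tt uv (λ col → sees (proj₁ ∘ same) col , sees (proj₂ ∘ same) col) w tt

  clique-order≤ω : ∀ {S ω} → IsCliqueNumber G ω → (K : Clique S) → order K ≤ ω
  clique-order≤ω (_ , maximum) K =
    maximum (tabulate (members K)) λ u v u∈K v∈K → adjacent K u v (∈-tabulate⁻ _ u∈K) (∈-tabulate⁻ _ v∈K)

mainTheorem6 : (n : ℕ) (G : Graph n) → IsCograph G →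
               (ω : ℕ) → IsCliqueNumber G ω →
               LidColorableWith G (2 * ω ∸ 1)
mainTheorem6 zero    G cograph ω clique-number = (λ ()) , (λ ()) , (λ ())
mainTheorem6 (suc m) G cograph ω clique-number with Induced.colourings G cograph _ everything ≤-refl (zero , tt)
... | K , C = lid-colourable G (lid-weaken (narrow-colouring C) (∸-monoˡ-≤ 1 (*-monoʳ-≤ 2 k≤ω)))
  where
  open Induced G
  k≤ω : order K ≤ ω
  k≤ω = clique-order≤ω G clique-number K
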